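{- Let $G$ be a connected graph with $n\ge2$ vertices $g_1,\dots,g_n$, and for $i=1,\dots,n$ let $H_i$ be a connected graph of order at least two together with a vertex $v_i$ of $H_i$ that belongs to some minimum dominating set of $H_i$. Let $G'=G\circ_{v_i}H_i$ be the graph obtained from the disjoint union of $G,H_1,\dots,H_n$ by adding the edges $g_iv_i$, $i=1,\dots,n$. For each $i$ let $S_i$ be a minimum dominating set of $H_i$ with $v_i\in S_i$. Then $\bigcup_{i=1}^n S_i$ is a global dominating set of $G'$ of minimum cardinality.
   Context: All graphs are finite and simple. A set $D$ of vertices is a dominating set of a graph if every vertex not in $D$ is adjacent to a vertex of $D$; a minimum dominating set is one of minimum cardinality. The complement of a graph has the same vertices and exactly the edges absent in the graph. A nonempty set $D$ is a global dominating set of a graph if it is a dominating set of both the graph and its complement. -}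

module Defs where

open import Data.Nat using (ℕ; zero; suc; _≤_)
open import Data.Bool using (Bool; true; false)
open import Data.Fin using (Fin)
open import Data.List using (List; []; _∷_; map; _++_; concatMap; allFin)
open import Data.Product using (Σ; ∃; _×_; _,_)
open import Data.Sum using (_⊎_; inj₁; inj₂)
open import Data.Empty using (⊥)
open import Relation.Nullary using (¬_)
open import Relation.Binary.PropositionalEquality using (_≡_; _≢_)
open import Relation.Binary.Construct.Closure.ReflexiveTransitive using (Star)

record Graph (V : Set) : Set₁ where
  field
    Adj    : V → V → Set
    sym    : ∀ {u v} → Adj u v → Adj v u
    irrefl : ∀ {v} → ¬ Adj v v
open Graph public

Connected : {V : Set} → Graph V → Set
Connected {V} G = (u v : V) → Star (Adj G) u v

-- Vertex subsets are Boolean predicates; cardinality is counted along an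
-- explicit duplicate-free complete enumeration of the vertex type.
count : {V : Set} → List V → (V → Bool) → ℕ
count [] D = 0
count (x ∷ xs) D with D x
... | true  = suc (count xs D)
... | false = count xs D

Dominating : {V : Set} → (V → V → Set) → (V → Bool) → Set
Dominating {V} A D = (v : V) → D v ≡ false → ∃ λ u → D u ≡ true × A v u

Compl : {V : Set} → (V → V → Set) → V → V → Set
Compl A u v = u ≢ v × ¬ A u v

MinDominating : {V : Set} → List V → (V → V → Set) → (V → Bool) → Set
MinDominating {V} elems A D =
  Dominating A D × ((D' : V → Bool) → Dominating A D' → count elems D ≤ count elems D')

GlobalDominating : {V : Set} → (V → V → Set) → (V → Bool) → Set
GlobalDominating {V} A D =
  (∃ λ v → D v ≡ true) × Dominating A D × Dominating (Compl A) D

MinGlobalDominating : {V : Set} → List V → (V → V → Set) → (V → Bool) → Set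
MinGlobalDominating {V} elems A D =
  GlobalDominating A D ×
  ((D' : V → Bool) → GlobalDominating A D' → count elems D ≤ count elems D')

CVert : (n : ℕ) → (m : Fin n → ℕ) → Set
CVert n m = Fin n ⊎ Σ (Fin n) (λ i → Fin (m i))

cElems : (n : ℕ) → (m : Fin n → ℕ) → List (CVert n m)
cElems n m = map inj₁ (allFin n)
          ++ concatMap (λ i → map (λ x → inj₂ (i , x)) (allFin (m i))) (allFin n)

data CAdj {n : ℕ} {m : Fin n → ℕ} (G : Graph (Fin n))
          (H : (i : Fin n) → Graph (Fin (m i))) (v : (i : Fin n) → Fin (m i))
          : CVert n m → CVert n m → Set where
  gg : ∀ {a b} → Adj G a b → CAdj G H v (inj₁ a) (inj₁ b)
  hh : ∀ {i x y} → Adj (H i) x y → CAdj G H v (inj₂ (i , x)) (inj₂ (i , y))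
  gh : ∀ {i} → CAdj G H v (inj₁ i) (inj₂ (i , v i))
  hg : ∀ {i} → CAdj G H v (inj₂ (i , v i)) (inj₁ i)

bigUnion : {n : ℕ} {m : Fin n → ℕ} → ((i : Fin n) → Fin (m i) → Bool) → CVert n m → Bool
bigUnion S (inj₁ _) = false
bigUnion S (inj₂ (i , x)) = S i x

-- Each H_i meets G′ only in the edge g_i v_i, so any dominating set D of G′
-- induces a dominating set of H_i: its trace on H_i, plus v_i when g_i ∈ D.
-- Hence |S_i| ≤ |D ∩ H_i| + |D ∩ {g_i}|, and summing over i gives
-- |⋃ S_i| ≤ |D|. The union dominates G′ because each g_i sees v_i ∈ S_i; it
-- dominates the complement because, as n ≥ 2, every vertex w of G′ lies
-- outside some copy H_j, and then v_j ∈ S_j is neither w nor adjacent to w.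
module Submission where

open import Defs hiding (sym)
open import Data.Nat using (ℕ; zero; suc; _≤_; _+_; z≤n; s≤s)
open import Data.Nat.Properties
  using (≤-trans; ≤-reflexive; +-mono-≤; +-monoʳ-≤; +-comm; +-suc; n≤1+n; +-commutativeSemigroup;
         module ≤-Reasoning)
open import Algebra.Properties.CommutativeSemigroup +-commutativeSemigroup using (interchange)
open import Data.Bool using (Bool; true; false; _∨_; _∧_)
open import Data.Bool.Properties using (∨-conicalˡ; ∨-zeroʳ)
open import Data.Fin using (Fin; zero; suc)
open import Data.Fin.Properties using (_≟_)
open import Data.List using (List; []; _∷_; [_]; map; _++_; concatMap; allFin; tabulate)
open import Data.List.Properties using (concatMap-map; concatMap-pure; map-tabulate)
open import Data.Product using (_×_; _,_; proj₁; proj₂; ∃)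
open import Data.Sum using (inj₁; inj₂)
open import Function using (_∘_; id)
open import Relation.Nullary using (does; contradiction)
open import Relation.Nullary.Decidable using (dec-true)
open import Relation.Binary.PropositionalEquality
  using (_≡_; _≢_; refl; sym; trans; cong; cong₂; module ≡-Reasoning)

module _ {A : Set} where

  count-++ : (xs ys : List A) (D : A → Bool) → count (xs ++ ys) D ≡ count xs D + count ys D
  count-++ []       ys D = refl
  count-++ (x ∷ xs) ys D with D x
  ... | true  = cong suc (count-++ xs ys D)
  ... | false = count-++ xs ys D

  count-map : {B : Set} (f : B → A) (xs : List B) (D : A → Bool) →
              count (map f xs) D ≡ count xs (D ∘ f)
  count-map f []       D = refl
  count-map f (x ∷ xs) D with D (f x)
  ... | true  = cong suc (count-map f xs D)
  ... | false = count-map f xs D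

  count-false : (xs : List A) → count xs (λ _ → false) ≡ 0
  count-false []       = refl
  count-false (x ∷ xs) = count-false xs

  count-∨ : (xs : List A) (P Q : A → Bool) →
            count xs (λ x → P x ∨ Q x) ≤ count xs P + count xs Q
  count-∨ []       P Q = z≤n
  count-∨ (x ∷ xs) P Q with P x | Q x
  ... | true  | true  = s≤s (≤-trans (count-∨ xs P Q) (+-monoʳ-≤ (count xs P) (n≤1+n (count xs Q))))
  ... | true  | false = s≤s (count-∨ xs P Q)
  ... | false | true  = ≤-trans (s≤s (count-∨ xs P Q)) (≤-reflexive (sym (+-suc _ _)))
  ... | false | false = count-∨ xs P Q

  count-concatMap-mono : {B : Set} (xs : List B) (F E F′ : B → List A) (D D′ : A → Bool) →
    (∀ x → count (F x) D ≤ count (E x) D′ + count (F′ x) D′) →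
    count (concatMap F xs) D ≤ count (concatMap E xs) D′ + count (concatMap F′ xs) D′
  count-concatMap-mono []       F E F′ D D′ le = z≤n
  count-concatMap-mono (x ∷ xs) F E F′ D D′ le = begin
    count (F x ++ concatMap F xs) D
      ≡⟨ count-++ (F x) _ D ⟩
    count (F x) D + count (concatMap F xs) D
      ≤⟨ +-mono-≤ (le x) (count-concatMap-mono xs F E F′ D D′ le) ⟩
    (count (E x) D′ + count (F′ x) D′) + (count (concatMap E xs) D′ + count (concatMap F′ xs) D′)
      ≡⟨ interchange (count (E x) D′) _ _ _ ⟩
    (count (E x) D′ + count (concatMap E xs) D′) + (count (F′ x) D′ + count (concatMap F′ xs) D′)
      ≡⟨ sym (cong₂ _+_ (count-++ (E x) _ D′) (count-++ (F′ x) _ D′)) ⟩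
    count (E x ++ concatMap E xs) D′ + count (F′ x ++ concatMap F′ xs) D′ ∎
    where open ≤-Reasoning

count-tabulate-suc : {k : ℕ} (D : Fin (suc k) → Bool) →
                     count (tabulate suc) D ≡ count (allFin k) (D ∘ suc)
count-tabulate-suc {k} D =
  trans (cong (λ xs → count xs D) (sym (map-tabulate id suc))) (count-map suc (allFin k) D)

count-allFin-≟ : {k : ℕ} (v : Fin k) → count (allFin k) (λ x → does (x ≟ v)) ≡ 1
count-allFin-≟ {suc k} zero =
  cong suc (trans (count-tabulate-suc {k} (λ x → does (x ≟ zero))) (count-false (allFin k)))
count-allFin-≟ {suc k} (suc v) =
  trans (count-tabulate-suc {k} (λ x → does (x ≟ suc v))) (count-allFin-≟ {k} v)

count-allFin-marked : {B : Set} {k : ℕ} (D : B → Bool) (y : B) (v : Fin k) →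
                      count (allFin k) (λ x → D y ∧ does (x ≟ v)) ≡ count [ y ] D
count-allFin-marked {k = k} D y v with D y
... | true  = count-allFin-≟ v
... | false = count-false (allFin k)

∃-≢ : {n : ℕ} → 2 ≤ n → (i : Fin n) → ∃ λ j → j ≢ i
∃-≢ (s≤s (s≤s z≤n)) zero    = suc zero , λ ()
∃-≢ (s≤s (s≤s z≤n)) (suc i) = zero , λ ()

module _ {n : ℕ} {m : Fin n → ℕ} (G : Graph (Fin n))
         (H : (i : Fin n) → Graph (Fin (m i))) (v : (i : Fin n) → Fin (m i)) where

  private
    G′ : CVert n m → CVert n m → Set
    G′ = CAdj G H v

  owner : CVert n m → Fin n
  owner (inj₁ i)       = i
  owner (inj₂ (i , _)) = i

  owner-adjacent-root : ∀ {w j} → G′ w (inj₂ (j , v j)) → owner w ≡ j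
  owner-adjacent-root (hh _) = refl
  owner-adjacent-root gh     = refl

  union-dominating : (S : (i : Fin n) → Fin (m i) → Bool) →
    (∀ i → Dominating (Adj (H i)) (S i)) → (∀ i → S i (v i) ≡ true) →
    Dominating G′ (bigUnion S)
  union-dominating S dom root (inj₁ i) _ = inj₂ (i , v i) , root i , gh
  union-dominating S dom root (inj₂ (i , x)) x∉S with dom i x x∉S
  ... | y , y∈S , xy = inj₂ (i , y) , y∈S , hh xy

  union-dominating-compl : 2 ≤ n → (S : (i : Fin n) → Fin (m i) → Bool) →
    (∀ i → S i (v i) ≡ true) → Dominating (Compl G′) (bigUnion S)
  union-dominating-compl 2≤n S root w _ =
    inj₂ (j , v j) , root j , j≢w ∘ sym ∘ cong owner , j≢w ∘ sym ∘ owner-adjacent-root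
    where
    j : Fin n
    j = proj₁ (∃-≢ 2≤n (owner w))
    j≢w : j ≢ owner w
    j≢w = proj₂ (∃-≢ 2≤n (owner w))

  trace : (CVert n m → Bool) → (i : Fin n) → Fin (m i) → Bool
  trace D i x = D (inj₂ (i , x)) ∨ (D (inj₁ i) ∧ does (x ≟ v i))

  trace-root : ∀ {D} i → D (inj₁ i) ≡ true → trace D i (v i) ≡ true
  trace-root {D} i g∈D = begin
    D (inj₂ (i , v i)) ∨ (D (inj₁ i) ∧ does (v i ≟ v i))
      ≡⟨ cong₂ (λ b c → D (inj₂ (i , v i)) ∨ (b ∧ c)) g∈D (dec-true (v i ≟ v i) refl) ⟩
    D (inj₂ (i , v i)) ∨ true
      ≡⟨ ∨-zeroʳ _ ⟩
    true ∎
    where open ≡-Reasoning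

  trace-dominating : ∀ {D} → Dominating G′ D → ∀ i → Dominating (Adj (H i)) (trace D i)
  trace-dominating {D} dom i x x∉trace
    with dom (inj₂ (i , x)) (∨-conicalˡ _ _ x∉trace)
  ... | inj₂ (_ , y) , y∈D , hh xy = y , cong (_∨ (D (inj₁ i) ∧ does (y ≟ v i))) y∈D , xy
  ... | inj₁ _       , g∈D , hg    = contradiction (trans (sym (trace-root {D} i g∈D)) x∉trace) λ ()

  copy : (i : Fin n) → List (CVert n m)
  copy i = map (λ x → inj₂ (i , x)) (allFin (m i))

  count-trace : ∀ D i → count (allFin (m i)) (trace D i) ≤ count [ inj₁ i ] D + count (copy i) D
  count-trace D i = begin
    count (allFin (m i)) (trace D i)
      ≤⟨ count-∨ (allFin (m i)) (λ x → D (inj₂ (i , x))) (λ x → D (inj₁ i) ∧ does (x ≟ v i)) ⟩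
    count (allFin (m i)) (λ x → D (inj₂ (i , x))) + count (allFin (m i)) (λ x → D (inj₁ i) ∧ does (x ≟ v i))
      ≡⟨ cong₂ _+_ (sym (count-map _ (allFin (m i)) D)) (count-allFin-marked D (inj₁ i) (v i)) ⟩
    count (copy i) D + count [ inj₁ i ] D
      ≡⟨ +-comm (count (copy i) D) _ ⟩
    count [ inj₁ i ] D + count (copy i) D ∎
    where open ≤-Reasoning

  union-count-minimum : (S : (i : Fin n) → Fin (m i) → Bool) →
    (∀ i → MinDominating (allFin (m i)) (Adj (H i)) (S i)) →
    ∀ {D} → Dominating G′ D → count (cElems n m) (bigUnion S) ≤ count (cElems n m) D
  union-count-minimum S min {D} dom = begin
    count (map inj₁ (allFin n) ++ concatMap copy (allFin n)) (bigUnion S)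
      ≡⟨ count-++ (map inj₁ (allFin n)) _ (bigUnion S) ⟩
    count (map inj₁ (allFin n)) (bigUnion S) + count (concatMap copy (allFin n)) (bigUnion S)
      ≡⟨ cong (_+ count (concatMap copy (allFin n)) (bigUnion S))
              (trans (count-map inj₁ (allFin n) (bigUnion S)) (count-false (allFin n))) ⟩
    count (concatMap copy (allFin n)) (bigUnion S)
      ≤⟨ count-concatMap-mono (allFin n) copy (λ i → [ inj₁ i ]) copy (bigUnion S) D component ⟩
    count (concatMap (λ i → [ inj₁ i ]) (allFin n)) D + count (concatMap copy (allFin n)) D
      ≡⟨ cong (λ xs → count xs D + count (concatMap copy (allFin n)) D) singletons ⟩
    count (map inj₁ (allFin n)) D + count (concatMap copy (allFin n)) D
      ≡⟨ sym (count-++ (map inj₁ (allFin n)) _ D) ⟩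
    count (map inj₁ (allFin n) ++ concatMap copy (allFin n)) D ∎
    where
    open ≤-Reasoning
    component : ∀ i → count (copy i) (bigUnion S) ≤ count [ inj₁ i ] D + count (copy i) D
    component i = begin
      count (copy i) (bigUnion S)      ≡⟨ count-map _ (allFin (m i)) (bigUnion S) ⟩
      count (allFin (m i)) (S i)       ≤⟨ proj₂ (min i) (trace D i) (trace-dominating dom i) ⟩
      count (allFin (m i)) (trace D i) ≤⟨ count-trace D i ⟩
      count [ inj₁ i ] D + count (copy i) D ∎
    singletons : concatMap (λ i → [ inj₁ i ]) (allFin n) ≡ map inj₁ (allFin n)
    singletons = trans (sym (concatMap-map [_] inj₁ (allFin n))) (concatMap-pure (map inj₁ (allFin n)))

proposition4 : (n : ℕ) → 2 ≤ n → (G : Graph (Fin n)) → Connected G →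
    (m : Fin n → ℕ) → (H : (i : Fin n) → Graph (Fin (m i))) →
    ((i : Fin n) → 2 ≤ m i) → ((i : Fin n) → Connected (H i)) →
    (v : (i : Fin n) → Fin (m i)) →
    (S : (i : Fin n) → Fin (m i) → Bool) →
    ((i : Fin n) → MinDominating (allFin (m i)) (Adj (H i)) (S i) × S i (v i) ≡ true) →
    MinGlobalDominating (cElems n m) (CAdj G H v) (bigUnion S)
proposition4 zero () _
proposition4 n@(suc _) 2≤n G _ m H _ _ v S hS =
    ( (inj₂ (zero , v zero) , root zero)
    , union-dominating G H v S (proj₁ ∘ min) root
    , union-dominating-compl G H v 2≤n S root )
  , λ D (_ , dom , _) → union-count-minimum G H v S min dom
  where
  min : ∀ i → MinDominating (allFin (m i)) (Adj (H i)) (S i)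
  min i = proj₁ (hS i)
  root : ∀ i → S i (v i) ≡ true
  root i = proj₂ (hS i)
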